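{- Let $n\geq 2$. Lattice terms $t_1,\dots,t_n\in\mathrm{Tm}(\overline{x})$ are $\mathcal{L}\mathit{at}$-dependent if and only if for some $i\in\{1,\dots,n\}$, \[ \models_{\mathcal{L}\mathit{at}} t_i\le\bigvee_{j\in[n]\setminus\{i\}}t_j \quad\text{or}\quad \models_{\mathcal{L}\mathit{at}}\bigwedge_{j\in[n]\setminus\{i\}}t_j\le t_i. \] Consequently, $\mathcal{L}\mathit{at}$-dependence (of finitely many lattice terms) is decidable.
   Context: $\mathcal{L}\mathit{at}$ is the variety of lattices, $[n]=\{1,\dots,n\}$, and $s\le t$ abbreviates $s\wedge t\approx s$. $\models_{\mathcal{L}\mathit{at}}\varepsilon$ means the equation $\varepsilon$ holds in every lattice under every assignment. Lattice terms $t_1,\dots,t_n\in\mathrm{Tm}(\overline{x})$ are $\mathcal{L}\mathit{at}$-dependent if there is a lattice equation $\varepsilon(y_1,\dots,y_n)$ (in new variables) with $\models_{\mathcal{L}\mathit{at}}\varepsilon(t_1,\dots,t_n)$ but $\not\models_{\mathcal{L}\mathit{at}}\varepsilon$; otherwise they are $\mathcal{L}\mathit{at}$-independent. -}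

module Defs where

open import Level using (0ℓ) renaming (suc to lsuc)
open import Data.Nat using (ℕ; zero; suc)
open import Data.Fin using (Fin; zero; suc; punchIn)
open import Data.Product using (Σ; _×_)
open import Relation.Nullary using (¬_)
open import Algebra.Lattice.Bundles using (Lattice)

data Tm (m : ℕ) : Set where
  var  : Fin m → Tm m
  _∧ₜ_ : Tm m → Tm m → Tm m
  _∨ₜ_ : Tm m → Tm m → Tm m

infixr 7 _∧ₜ_
infixr 6 _∨ₜ_

⟦_⟧ : ∀ {m} → Tm m → (L : Lattice 0ℓ 0ℓ) → (Fin m → Lattice.Carrier L) → Lattice.Carrier L
⟦ var x ⟧    L ρ = ρ x
⟦ s ∧ₜ t ⟧   L ρ = Lattice._∧_ L (⟦ s ⟧ L ρ) (⟦ t ⟧ L ρ)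
⟦ s ∨ₜ t ⟧   L ρ = Lattice._∨_ L (⟦ s ⟧ L ρ) (⟦ t ⟧ L ρ)

record Eqn (m : ℕ) : Set where
  constructor _≈ₑ_
  field
    lhs : Tm m
    rhs : Tm m

⊨Lat : ∀ {m} → Eqn m → Set₁
⊨Lat {m} (s ≈ₑ t) = (L : Lattice 0ℓ 0ℓ) (ρ : Fin m → Lattice.Carrier L) →
  Lattice._≈_ L (⟦ s ⟧ L ρ) (⟦ t ⟧ L ρ)

_≤ₑ_ : ∀ {m} → Tm m → Tm m → Eqn m
s ≤ₑ t = (s ∧ₜ t) ≈ₑ s

_[_] : ∀ {n m} → Tm n → (Fin n → Tm m) → Tm m
var y    [ σ ] = σ y
(s ∧ₜ t) [ σ ] = (s [ σ ]) ∧ₜ (t [ σ ])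
(s ∨ₜ t) [ σ ] = (s [ σ ]) ∨ₜ (t [ σ ])

_[_]ₑ : ∀ {n m} → Eqn n → (Fin n → Tm m) → Eqn m
(s ≈ₑ t) [ σ ]ₑ = (s [ σ ]) ≈ₑ (t [ σ ])

LatDependent : ∀ {n m} → (Fin n → Tm m) → Set₁
LatDependent {n} ts = Σ (Eqn n) λ ε → ⊨Lat (ε [ ts ]ₑ) × ¬ ⊨Lat ε

⋁ : ∀ {k m} → (Fin (suc k) → Tm m) → Tm m
⋁ {zero}  f = f zero
⋁ {suc k} f = f zero ∨ₜ ⋁ (λ j → f (suc j))

⋀ : ∀ {k m} → (Fin (suc k) → Tm m) → Tm m
⋀ {zero}  f = f zero
⋀ {suc k} f = f zero ∧ₜ ⋀ (λ j → f (suc j))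

others : ∀ {k m} → (Fin (suc k) → Tm m) → Fin (suc k) → Fin k → Tm m
others ts i j = ts (punchIn i j)

-- Validity of lattice inequalities is captured by Whitman's cut-free calculus _⊑_, which is
-- sound for all lattices and complete because the terms themselves form the free lattice.
-- If no tᵢ lies below the join or above the meet of the others, then substituting the tᵢ for
-- the variables reflects ⊑: in a derivation of p[t] ⊑ q[t] with p = yᵢ and yᵢ ⋢ q, one can
-- always pick a branch of q avoiding yᵢ, giving q[t] ⊑ ⋁_{j≠i} tⱼ and hence tᵢ ⊑ ⋁_{j≠i} tⱼ;
-- dually when q = yⱼ. So every equation satisfied by the tᵢ is valid, i.e. they are
-- independent. Conversely, yᵢ ≤ ⋁_{j≠i} yⱼ and its dual are not valid.
module Submission where

open import Defs
open import Level using (0ℓ)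
open import Data.Nat using (ℕ; zero; suc)
open import Data.Fin using (Fin; zero; suc; punchIn; punchOut; _≟_)
open import Data.Fin.Properties using (punchInᵢ≢i; punchIn-punchOut; any?)
open import Data.Product using (Σ; _×_; _,_; proj₁; proj₂; uncurry)
open import Data.Sum using (_⊎_; inj₁; inj₂; [_,_])
open import Function.Base using (_∘_)
open import Function.Bundles using (_⇔_; mk⇔)
open import Relation.Nullary using (¬_; Dec; yes; no)
open import Relation.Nullary.Decidable using (map′; _⊎-dec_; _×-dec_; decidable-stable)
open import Relation.Binary.PropositionalEquality using (_≡_; _≢_; refl; sym; cong; cong₂; subst; subst₂)
open import Algebra.Lattice.Bundles using (Lattice)
import Algebra.Lattice.Properties.Lattice as LatticeProperties
import Relation.Binary.Lattice as OrderLattice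
open import Relation.Binary.Lattice.Properties.Lattice using (algLattice)

infix 4 _⊑_

data _⊑_ {m : ℕ} : Tm m → Tm m → Set where
  var      : ∀ {x} → var x ⊑ var x
  ∨-left   : ∀ {a b c} → a ⊑ c → b ⊑ c → a ∨ₜ b ⊑ c
  ∧-right  : ∀ {a b c} → a ⊑ b → a ⊑ c → a ⊑ b ∧ₜ c
  ∨-right₁ : ∀ {a b c} → a ⊑ b → a ⊑ b ∨ₜ c
  ∨-right₂ : ∀ {a b c} → a ⊑ c → a ⊑ b ∨ₜ c
  ∧-left₁  : ∀ {a b c} → a ⊑ c → a ∧ₜ b ⊑ c
  ∧-left₂  : ∀ {a b c} → b ⊑ c → a ∧ₜ b ⊑ c

module _ {m : ℕ} where

  ⊑-refl : (a : Tm m) → a ⊑ a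
  ⊑-refl (var x)  = var
  ⊑-refl (a ∧ₜ b) = ∧-right (∧-left₁ (⊑-refl a)) (∧-left₂ (⊑-refl b))
  ⊑-refl (a ∨ₜ b) = ∨-left (∨-right₁ (⊑-refl a)) (∨-right₂ (⊑-refl b))

  -- Cut elimination: the principal cases reduce to cuts on the immediate subterms.
  ⊑-trans : ∀ {a b c : Tm m} → a ⊑ b → b ⊑ c → a ⊑ c
  ⊑-trans (∨-left d₁ d₂) e        = ∨-left (⊑-trans d₁ e) (⊑-trans d₂ e)
  ⊑-trans (∧-left₁ d) e           = ∧-left₁ (⊑-trans d e)
  ⊑-trans (∧-left₂ d) e           = ∧-left₂ (⊑-trans d e)
  ⊑-trans d (∧-right e₁ e₂)       = ∧-right (⊑-trans d e₁) (⊑-trans d e₂)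
  ⊑-trans d (∨-right₁ e)          = ∨-right₁ (⊑-trans d e)
  ⊑-trans d (∨-right₂ e)          = ∨-right₂ (⊑-trans d e)
  ⊑-trans var e                   = e
  ⊑-trans (∧-right d₁ d₂) (∧-left₁ e) = ⊑-trans d₁ e
  ⊑-trans (∧-right d₁ d₂) (∧-left₂ e) = ⊑-trans d₂ e
  ⊑-trans (∨-right₁ d) (∨-left e₁ e₂) = ⊑-trans d e₁
  ⊑-trans (∨-right₂ d) (∨-left e₁ e₂) = ⊑-trans d e₂

  ∨-left⁻¹ : ∀ {a b c : Tm m} → a ∨ₜ b ⊑ c → a ⊑ c × b ⊑ c
  ∨-left⁻¹ (∨-left d e)  = d , e
  ∨-left⁻¹ (∧-right d e) = ∧-right (proj₁ (∨-left⁻¹ d)) (proj₁ (∨-left⁻¹ e))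
                         , ∧-right (proj₂ (∨-left⁻¹ d)) (proj₂ (∨-left⁻¹ e))
  ∨-left⁻¹ (∨-right₁ d)  = ∨-right₁ (proj₁ (∨-left⁻¹ d)) , ∨-right₁ (proj₂ (∨-left⁻¹ d))
  ∨-left⁻¹ (∨-right₂ d)  = ∨-right₂ (proj₁ (∨-left⁻¹ d)) , ∨-right₂ (proj₂ (∨-left⁻¹ d))

  ∧-right⁻¹ : ∀ {a b c : Tm m} → a ⊑ b ∧ₜ c → a ⊑ b × a ⊑ c
  ∧-right⁻¹ (∧-right d e) = d , e
  ∧-right⁻¹ (∨-left d e)  = ∨-left (proj₁ (∧-right⁻¹ d)) (proj₁ (∧-right⁻¹ e))
                          , ∨-left (proj₂ (∧-right⁻¹ d)) (proj₂ (∧-right⁻¹ e))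
  ∧-right⁻¹ (∧-left₁ d)   = ∧-left₁ (proj₁ (∧-right⁻¹ d)) , ∧-left₁ (proj₂ (∧-right⁻¹ d))
  ∧-right⁻¹ (∧-left₂ d)   = ∧-left₂ (proj₁ (∧-right⁻¹ d)) , ∧-left₂ (proj₂ (∧-right⁻¹ d))

  var⊑var⁻¹ : ∀ {x y : Fin m} → var x ⊑ var y → x ≡ y
  var⊑var⁻¹ var = refl

  var⊑∨⁻¹ : ∀ {x : Fin m} {a b} → var x ⊑ a ∨ₜ b → var x ⊑ a ⊎ var x ⊑ b
  var⊑∨⁻¹ (∨-right₁ d) = inj₁ d
  var⊑∨⁻¹ (∨-right₂ d) = inj₂ d

  ∧⊑var⁻¹ : ∀ {y : Fin m} {a b} → a ∧ₜ b ⊑ var y → a ⊑ var y ⊎ b ⊑ var y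
  ∧⊑var⁻¹ (∧-left₁ d) = inj₁ d
  ∧⊑var⁻¹ (∧-left₂ d) = inj₂ d

  whitman : ∀ {a₁ a₂ b₁ b₂ : Tm m} → a₁ ∧ₜ a₂ ⊑ b₁ ∨ₜ b₂ →
            (a₁ ⊑ b₁ ∨ₜ b₂ ⊎ a₂ ⊑ b₁ ∨ₜ b₂) ⊎ (a₁ ∧ₜ a₂ ⊑ b₁ ⊎ a₁ ∧ₜ a₂ ⊑ b₂)
  whitman (∧-left₁ d)  = inj₁ (inj₁ d)
  whitman (∧-left₂ d)  = inj₁ (inj₂ d)
  whitman (∨-right₁ d) = inj₂ (inj₁ d)
  whitman (∨-right₂ d) = inj₂ (inj₂ d)

  _⊑?_ : (a b : Tm m) → Dec (a ⊑ b)
  (a₁ ∨ₜ a₂) ⊑? b = map′ (uncurry ∨-left) ∨-left⁻¹ ((a₁ ⊑? b) ×-dec (a₂ ⊑? b))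
  a ⊑? (b₁ ∧ₜ b₂) = map′ (uncurry ∧-right) ∧-right⁻¹ ((a ⊑? b₁) ×-dec (a ⊑? b₂))
  var x ⊑? var y = map′ (λ { refl → var }) var⊑var⁻¹ (x ≟ y)
  var x ⊑? (b₁ ∨ₜ b₂) =
    map′ [ ∨-right₁ , ∨-right₂ ] var⊑∨⁻¹ ((var x ⊑? b₁) ⊎-dec (var x ⊑? b₂))
  (a₁ ∧ₜ a₂) ⊑? var y =
    map′ [ ∧-left₁ , ∧-left₂ ] ∧⊑var⁻¹ ((a₁ ⊑? var y) ⊎-dec (a₂ ⊑? var y))
  (a₁ ∧ₜ a₂) ⊑? (b₁ ∨ₜ b₂) =
    map′ [ [ ∧-left₁ , ∧-left₂ ] , [ ∨-right₁ , ∨-right₂ ] ] whitman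
      (((a₁ ⊑? (b₁ ∨ₜ b₂)) ⊎-dec (a₂ ⊑? (b₁ ∨ₜ b₂)))
        ⊎-dec (((a₁ ∧ₜ a₂) ⊑? b₁) ⊎-dec ((a₁ ∧ₜ a₂) ⊑? b₂)))

  termLattice : OrderLattice.Lattice 0ℓ 0ℓ 0ℓ
  termLattice = record
    { Carrier = Tm m
    ; _≈_ = λ a b → a ⊑ b × b ⊑ a
    ; _≤_ = _⊑_
    ; _∨_ = _∨ₜ_
    ; _∧_ = _∧ₜ_
    ; isLattice = record
      { isPartialOrder = record
        { isPreorder = record
          { isEquivalence = record
            { refl  = λ {a} → ⊑-refl a , ⊑-refl a
            ; sym   = λ (p , q) → q , p
            ; trans = λ (p , q) (r , s) → ⊑-trans p r , ⊑-trans s q }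
          ; reflexive = proj₁
          ; trans = ⊑-trans }
        ; antisym = _,_ }
      ; supremum = λ a b → ∨-right₁ (⊑-refl a) , ∨-right₂ (⊑-refl b) , λ _ → ∨-left
      ; infimum  = λ a b → ∧-left₁ (⊑-refl a) , ∧-left₂ (⊑-refl b) , λ _ → ∧-right } }

  freeLattice : Lattice 0ℓ 0ℓ
  freeLattice = algLattice termLattice

  ⟦⟧-var : (a : Tm m) → ⟦ a ⟧ freeLattice var ≡ a
  ⟦⟧-var (var x)  = refl
  ⟦⟧-var (a ∧ₜ b) = cong₂ _∧ₜ_ (⟦⟧-var a) (⟦⟧-var b)
  ⟦⟧-var (a ∨ₜ b) = cong₂ _∨ₜ_ (⟦⟧-var a) (⟦⟧-var b)

  ≈-complete : ∀ {a b : Tm m} → ⊨Lat (a ≈ₑ b) → a ⊑ b × b ⊑ a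
  ≈-complete {a} {b} ⊨a≈b =
    subst₂ (λ a′ b′ → a′ ⊑ b′ × b′ ⊑ a′) (⟦⟧-var a) (⟦⟧-var b) (⊨a≈b freeLattice var)

  ⊑-complete : ∀ {a b : Tm m} → ⊨Lat (a ≤ₑ b) → a ⊑ b
  ⊑-complete {a} {b} ⊨a≤b = ⊑-trans (proj₂ (≈-complete {a ∧ₜ b} {a} ⊨a≤b)) (∧-left₂ (⊑-refl b))

  module _ (L : Lattice 0ℓ 0ℓ) (ρ : Fin m → Lattice.Carrier L) where
    open LatticeProperties L using (∨-∧-orderTheoreticLattice)
    open OrderLattice.Lattice ∨-∧-orderTheoreticLattice
      using (_≤_; ∨-least; ∧-greatest; x≤x∨y; y≤x∨y; x∧y≤x; x∧y≤y; antisym)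
      renaming (refl to ≤-refl; trans to ≤-trans)

    ⊑⇒≤ : ∀ {a b : Tm m} → a ⊑ b → ⟦ a ⟧ L ρ ≤ ⟦ b ⟧ L ρ
    ⊑⇒≤ var           = ≤-refl
    ⊑⇒≤ (∨-left d e)  = ∨-least (⊑⇒≤ d) (⊑⇒≤ e)
    ⊑⇒≤ (∧-right d e) = ∧-greatest (⊑⇒≤ d) (⊑⇒≤ e)
    ⊑⇒≤ (∨-right₁ d)  = ≤-trans (⊑⇒≤ d) (x≤x∨y _ _)
    ⊑⇒≤ (∨-right₂ d)  = ≤-trans (⊑⇒≤ d) (y≤x∨y _ _)
    ⊑⇒≤ (∧-left₁ d)   = ≤-trans (x∧y≤x _ _) (⊑⇒≤ d)
    ⊑⇒≤ (∧-left₂ d)   = ≤-trans (x∧y≤y _ _) (⊑⇒≤ d)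

    ⊑⊒⇒≈ : ∀ {a b : Tm m} → a ⊑ b → b ⊑ a → Lattice._≈_ L (⟦ a ⟧ L ρ) (⟦ b ⟧ L ρ)
    ⊑⊒⇒≈ d e = antisym (⊑⇒≤ d) (⊑⇒≤ e)

  ⊑-sound : ∀ {a b : Tm m} → a ⊑ b → ⊨Lat (a ≤ₑ b)
  ⊑-sound d L ρ = Lattice.sym L (⊑⇒≤ L ρ d)

  ≈-sound : ∀ {a b : Tm m} → a ⊑ b → b ⊑ a → ⊨Lat (a ≈ₑ b)
  ≈-sound d e L ρ = ⊑⊒⇒≈ L ρ d e

  ⊨≤ₑ? : (a b : Tm m) → Dec (⊨Lat (a ≤ₑ b))
  ⊨≤ₑ? a b = map′ ⊑-sound ⊑-complete (a ⊑? b)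

  ⊑-⋁ : ∀ {k} (f : Fin (suc k) → Tm m) (j : Fin (suc k)) → f j ⊑ ⋁ f
  ⊑-⋁ {zero}  f zero    = ⊑-refl (f zero)
  ⊑-⋁ {suc k} f zero    = ∨-right₁ (⊑-refl (f zero))
  ⊑-⋁ {suc k} f (suc j) = ∨-right₂ (⊑-⋁ (λ j → f (suc j)) j)

  ⋀-⊑ : ∀ {k} (f : Fin (suc k) → Tm m) (j : Fin (suc k)) → ⋀ f ⊑ f j
  ⋀-⊑ {zero}  f zero    = ⊑-refl (f zero)
  ⋀-⊑ {suc k} f zero    = ∧-left₁ (⊑-refl (f zero))
  ⋀-⊑ {suc k} f (suc j) = ∧-left₂ (⋀-⊑ (λ j → f (suc j)) j)

  var⋢⋁var : ∀ {k} (i : Fin m) (g : Fin (suc k) → Fin m) → (∀ j → g j ≢ i) →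
             ¬ var i ⊑ ⋁ (λ j → var (g j))
  var⋢⋁var {zero}  i g g≢i d = g≢i zero (sym (var⊑var⁻¹ d))
  var⋢⋁var {suc k} i g g≢i d with var⊑∨⁻¹ d
  ... | inj₁ d′ = g≢i zero (sym (var⊑var⁻¹ d′))
  ... | inj₂ d′ = var⋢⋁var i (λ j → g (suc j)) (λ j → g≢i (suc j)) d′

  ⋀var⋢var : ∀ {k} (i : Fin m) (g : Fin (suc k) → Fin m) → (∀ j → g j ≢ i) →
             ¬ ⋀ (λ j → var (g j)) ⊑ var i
  ⋀var⋢var {zero}  i g g≢i d = g≢i zero (var⊑var⁻¹ d)
  ⋀var⋢var {suc k} i g g≢i d with ∧⊑var⁻¹ d
  ... | inj₁ d′ = g≢i zero (var⊑var⁻¹ d′)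
  ... | inj₂ d′ = ⋀var⋢var i (λ j → g (suc j)) (λ j → g≢i (suc j)) d′

⋁-[] : ∀ {k n m} (f : Fin (suc k) → Tm n) (σ : Fin n → Tm m) → ⋁ f [ σ ] ≡ ⋁ (λ j → f j [ σ ])
⋁-[] {zero}  f σ = refl
⋁-[] {suc k} f σ = cong (f zero [ σ ] ∨ₜ_) (⋁-[] (λ j → f (suc j)) σ)

⋀-[] : ∀ {k n m} (f : Fin (suc k) → Tm n) (σ : Fin n → Tm m) → ⋀ f [ σ ] ≡ ⋀ (λ j → f j [ σ ])
⋀-[] {zero}  f σ = refl
⋀-[] {suc k} f σ = cong (f zero [ σ ] ∧ₜ_) (⋀-[] (λ j → f (suc j)) σ)

module _ {k m : ℕ} (ts : Fin (suc (suc k)) → Tm m) where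

  ⊑-⋁others : ∀ {i j} → i ≢ j → ts j ⊑ ⋁ (others ts i)
  ⊑-⋁others i≢j =
    subst (_⊑ ⋁ (others ts _)) (cong ts (punchIn-punchOut i≢j)) (⊑-⋁ (others ts _) (punchOut i≢j))

  ⋀others-⊑ : ∀ {i j} → i ≢ j → ⋀ (others ts i) ⊑ ts j
  ⋀others-⊑ i≢j =
    subst (⋀ (others ts _) ⊑_) (cong ts (punchIn-punchOut i≢j)) (⋀-⊑ (others ts _) (punchOut i≢j))

  -- A derivation of yᵢ ⊑ q would need yᵢ in every ∧-branch of q, so some branch avoids yᵢ.
  []-⊑-⋁others : ∀ i q → ¬ var i ⊑ q → q [ ts ] ⊑ ⋁ (others ts i)
  []-⊑-⋁others i (var j) yᵢ⋢yⱼ = ⊑-⋁others λ { refl → yᵢ⋢yⱼ var }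
  []-⊑-⋁others i (q₁ ∨ₜ q₂) yᵢ⋢q =
    ∨-left ([]-⊑-⋁others i q₁ (yᵢ⋢q ∘ ∨-right₁)) ([]-⊑-⋁others i q₂ (yᵢ⋢q ∘ ∨-right₂))
  []-⊑-⋁others i (q₁ ∧ₜ q₂) yᵢ⋢q with var i ⊑? q₁
  ... | yes yᵢ⊑q₁ = ∧-left₂ ([]-⊑-⋁others i q₂ λ yᵢ⊑q₂ → yᵢ⋢q (∧-right yᵢ⊑q₁ yᵢ⊑q₂))
  ... | no  yᵢ⋢q₁ = ∧-left₁ ([]-⊑-⋁others i q₁ yᵢ⋢q₁)

  []-⋀others-⊑ : ∀ i p → ¬ p ⊑ var i → ⋀ (others ts i) ⊑ p [ ts ]
  []-⋀others-⊑ i (var j) yⱼ⋢yᵢ = ⋀others-⊑ λ { refl → yⱼ⋢yᵢ var }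
  []-⋀others-⊑ i (p₁ ∧ₜ p₂) p⋢yᵢ =
    ∧-right ([]-⋀others-⊑ i p₁ (p⋢yᵢ ∘ ∧-left₁)) ([]-⋀others-⊑ i p₂ (p⋢yᵢ ∘ ∧-left₂))
  []-⋀others-⊑ i (p₁ ∨ₜ p₂) p⋢yᵢ with p₁ ⊑? var i
  ... | yes p₁⊑yᵢ = ∨-right₂ ([]-⋀others-⊑ i p₂ λ p₂⊑yᵢ → p⋢yᵢ (∨-left p₁⊑yᵢ p₂⊑yᵢ))
  ... | no  p₁⋢yᵢ = ∨-right₁ ([]-⋀others-⊑ i p₁ p₁⋢yᵢ)

  module _ (⋢⋁others : ∀ i → ¬ ts i ⊑ ⋁ (others ts i))
           (⋀others⋢ : ∀ i → ¬ ⋀ (others ts i) ⊑ ts i) where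

    []-reflects-⊑ : ∀ p q → p [ ts ] ⊑ q [ ts ] → p ⊑ q
    []-reflects-⊑ (p₁ ∨ₜ p₂) q d =
      ∨-left ([]-reflects-⊑ p₁ q (proj₁ (∨-left⁻¹ d))) ([]-reflects-⊑ p₂ q (proj₂ (∨-left⁻¹ d)))
    []-reflects-⊑ p (q₁ ∧ₜ q₂) d =
      ∧-right ([]-reflects-⊑ p q₁ (proj₁ (∧-right⁻¹ d))) ([]-reflects-⊑ p q₂ (proj₂ (∧-right⁻¹ d)))
    []-reflects-⊑ (var i) q d = decidable-stable (var i ⊑? q) λ yᵢ⋢q →
      ⋢⋁others i (⊑-trans d ([]-⊑-⋁others i q yᵢ⋢q))
    []-reflects-⊑ (p₁ ∧ₜ p₂) (var j) d = decidable-stable ((p₁ ∧ₜ p₂) ⊑? var j) λ p⋢yⱼ →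
      ⋀others⋢ j (⊑-trans ([]-⋀others-⊑ j (p₁ ∧ₜ p₂) p⋢yⱼ) d)
    []-reflects-⊑ (p₁ ∧ₜ p₂) (q₁ ∨ₜ q₂) (∧-left₁ d)  = ∧-left₁ ([]-reflects-⊑ p₁ (q₁ ∨ₜ q₂) d)
    []-reflects-⊑ (p₁ ∧ₜ p₂) (q₁ ∨ₜ q₂) (∧-left₂ d)  = ∧-left₂ ([]-reflects-⊑ p₂ (q₁ ∨ₜ q₂) d)
    []-reflects-⊑ (p₁ ∧ₜ p₂) (q₁ ∨ₜ q₂) (∨-right₁ d) = ∨-right₁ ([]-reflects-⊑ (p₁ ∧ₜ p₂) q₁ d)
    []-reflects-⊑ (p₁ ∧ₜ p₂) (q₁ ∨ₜ q₂) (∨-right₂ d) = ∨-right₂ ([]-reflects-⊑ (p₁ ∧ₜ p₂) q₂ d)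

    ⊨-[]-reflects : (ε : Eqn (suc (suc k))) → ⊨Lat (ε [ ts ]ₑ) → ⊨Lat ε
    ⊨-[]-reflects (s ≈ₑ t) ⊨ε[ts] =
      let d , e = ≈-complete ⊨ε[ts] in ≈-sound ([]-reflects-⊑ s t d) ([]-reflects-⊑ t s e)

Covered : ∀ {k m} → (Fin (suc (suc k)) → Tm m) → Fin (suc (suc k)) → Set₁
Covered ts i = ⊨Lat (ts i ≤ₑ ⋁ (others ts i)) ⊎ ⊨Lat (⋀ (others ts i) ≤ₑ ts i)

covered? : ∀ {k m} (ts : Fin (suc (suc k)) → Tm m) → Dec (Σ _ (Covered ts))
covered? ts = any? λ i → ⊨≤ₑ? (ts i) (⋁ (others ts i)) ⊎-dec ⊨≤ₑ? (⋀ (others ts i)) (ts i)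

covered⇒dependent : ∀ {k m} (ts : Fin (suc (suc k)) → Tm m) → Σ _ (Covered ts) → LatDependent ts
covered⇒dependent ts (i , inj₁ ⊨tᵢ≤⋁) =
  var i ≤ₑ ⋁ (others var i) ,
  subst (λ t → ⊨Lat ((ts i ∧ₜ t) ≈ₑ ts i)) (sym (⋁-[] (others var i) ts)) ⊨tᵢ≤⋁ ,
  var⋢⋁var i (punchIn i) (punchInᵢ≢i i) ∘ ⊑-complete
covered⇒dependent ts (i , inj₂ ⊨⋀≤tᵢ) =
  ⋀ (others var i) ≤ₑ var i ,
  subst (λ t → ⊨Lat ((t ∧ₜ ts i) ≈ₑ t)) (sym (⋀-[] (others var i) ts)) ⊨⋀≤tᵢ ,
  ⋀var⋢var i (punchIn i) (punchInᵢ≢i i) ∘ ⊑-complete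

uncovered⇒independent : ∀ {k m} (ts : Fin (suc (suc k)) → Tm m) →
                        ¬ Σ _ (Covered ts) → ¬ LatDependent ts
uncovered⇒independent ts uncovered (ε , ⊨ε[ts] , ⊭ε) = ⊭ε (⊨-[]-reflects ts
  (λ i d → uncovered (i , inj₁ (⊑-sound d)))
  (λ i d → uncovered (i , inj₂ (⊑-sound d))) ε ⊨ε[ts])

dependent⇒covered : ∀ {k m} (ts : Fin (suc (suc k)) → Tm m) → LatDependent ts → Σ _ (Covered ts)
dependent⇒covered ts dep =
  decidable-stable (covered? ts) λ uncovered → uncovered⇒independent ts uncovered dep

mainTheorem8 : (k m : ℕ) → (ts : Fin (suc (suc k)) → Tm m) →
    (LatDependent ts ⇔
    Σ (Fin (suc (suc k))) λ i →
    ⊨Lat (ts i ≤ₑ ⋁ (others ts i)) ⊎ ⊨Lat (⋀ (others ts i) ≤ₑ ts i))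
    × Dec (LatDependent ts)
mainTheorem8 k m ts = mk⇔ (dependent⇒covered ts) (covered⇒dependent ts)
                    , map′ (covered⇒dependent ts) (dependent⇒covered ts) (covered? ts)
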